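{- Let $\mathcal{B}$ be a finite relational structure with domain $B$, $|B|\geq 2$. Suppose $g$ is a she of $\mathcal{B}$ for which there are $b\in B$ and a partition of $B$ into disjoint sets $B',B''$ with $B'\neq\emptyset$ such that $g(x)\supseteq\{x,b\}$ for all $x\in B'$, $g(x)\supseteq\{b\}$ for all $x\in B''$, and for every $y\in B$ there is $x\in B'$ with $y\in g(x)$. Let $\varphi(u,\mathbf{v})$ be a formula of $\{\exists,\forall,\wedge,\vee\}$-FO, where $\mathbf{v}$ has arity $k$. Then for all $\mathbf{x}=(x_1,\dots,x_k)\in(B'\cup\{b\})^k$: (I) if $\mathcal{B}\models\varphi(u,\mathbf{x})$ for all $u\in B'$, then $\mathcal{B}\models\forall u\,\varphi(u,\mathbf{x})$; (II) if $\mathcal{B}\models\exists u\,\varphi(u,\mathbf{x})$ then $\mathcal{B}\models\varphi(b,\mathbf{x})$.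
   Context: $\{\exists,\forall,\wedge,\vee\}$-FO is the set of first-order formulas over the signature of $\mathcal{B}$ built from relational atoms using only $\wedge,\vee,\exists,\forall$ (no equality, no negation). A shop on $B$ is a map $f:B\to\mathfrak{P}(B)\setminus\{\emptyset\}$ with every $y\in B$ in some $f(x)$; a she of $\mathcal{B}$ is a shop $f$ such that for each relation $R$ of $\mathcal{B}$, $\mathcal{B}\models R(x_1,\dots,x_i)$ implies $\mathcal{B}\models R(y_1,\dots,y_i)$ for all $y_j\in f(x_j)$. -}

module Defs where

open import Data.Nat using (ℕ; suc)
open import Data.Fin using (Fin; zero; suc)
open import Data.Fin.Subset using (Subset; _∈_; _∉_)
open import Data.Product using (Σ; ∃; _×_; _,_)
open import Data.Sum using (_⊎_)
open import Data.Empty using (⊥)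
open import Level using (Level; suc; _⊔_) renaming (zero to lzero)

record Signature : Set where
  field
    nsym  : ℕ
    arity : Fin nsym → ℕ
open Signature public

record Structure (σ : Signature) : Set₁ where
  field
    size : ℕ
    rel  : (R : Fin (nsym σ)) → (Fin (arity σ R) → Fin size) → Set
open Structure public

-- {∃,∀,∧,∨}-FO formulas with free variables among Fin s (de Bruijn style:
-- the quantifiers bind variable `zero`, the outer variables are shifted by `suc`).
-- Atoms are relational atoms R(t₁,…,tᵢ) only (no equality, no negation).
data Formula (σ : Signature) : ℕ → Set where
  atom : ∀ {s} (R : Fin (nsym σ)) → (Fin (arity σ R) → Fin s) → Formula σ s
  _∧ᶠ_ : ∀ {s} → Formula σ s → Formula σ s → Formula σ s
  _∨ᶠ_ : ∀ {s} → Formula σ s → Formula σ s → Formula σ s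
  ∃ᶠ   : ∀ {s} → Formula σ (ℕ.suc s) → Formula σ s
  ∀ᶠ   : ∀ {s} → Formula σ (ℕ.suc s) → Formula σ s

_∷ₐ_ : ∀ {n s} → Fin n → (Fin s → Fin n) → (Fin (ℕ.suc s) → Fin n)
(a ∷ₐ ρ) zero    = a
(a ∷ₐ ρ) (suc i) = ρ i

_⊨_[_] : ∀ {σ s} (𝓑 : Structure σ) → Formula σ s → (Fin s → Fin (size 𝓑)) → Set
𝓑 ⊨ atom R ts [ ρ ] = rel 𝓑 R (λ j → ρ (ts j))
𝓑 ⊨ φ ∧ᶠ ψ   [ ρ ] = (𝓑 ⊨ φ [ ρ ]) × (𝓑 ⊨ ψ [ ρ ])
𝓑 ⊨ φ ∨ᶠ ψ   [ ρ ] = (𝓑 ⊨ φ [ ρ ]) ⊎ (𝓑 ⊨ ψ [ ρ ])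
𝓑 ⊨ ∃ᶠ φ     [ ρ ] = Σ (Fin (size 𝓑)) λ a → 𝓑 ⊨ φ [ a ∷ₐ ρ ]
𝓑 ⊨ ∀ᶠ φ     [ ρ ] = (a : Fin (size 𝓑)) → 𝓑 ⊨ φ [ a ∷ₐ ρ ]

record IsShop {n : ℕ} (f : Fin n → Subset n) : Set where
  field
    nonempty : ∀ x → ∃ λ y → y ∈ f x
    covering : ∀ y → ∃ λ x → y ∈ f x

record IsShe {σ} (𝓑 : Structure σ) (f : Fin (size 𝓑) → Subset (size 𝓑)) : Set where
  field
    shop     : IsShop f
    preserve : ∀ (R : Fin (nsym σ)) (xs ys : Fin (arity σ R) → Fin (size 𝓑)) →
               rel 𝓑 R xs → (∀ j → ys j ∈ f (xs j)) → rel 𝓑 R ys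

-- A she g transports satisfaction of {∃,∀,∧,∨}-formulas from an assignment ρ
-- to any ρ′ with ρ′ i ∈ g (ρ i): atoms by the definition of a she, ∃ because
-- every g a is non-empty, ∀ because the sets g a cover B.  Here g is reflexive
-- on B′ ∪ {b}, so the parameters xs may stay fixed.  For (I), each y lies in
-- g x for some x ∈ B′, so φ(x, xs) transports to φ(y, xs); for (II), b lies in
-- every g u, so φ(u, xs) transports to φ(b, xs).
module Submission where

open import Defs
open import Data.Nat using (ℕ; _≤_; suc)
open import Data.Fin as Fin using (Fin; zero)
open import Data.Fin.Subset using (Subset; _∈_)
open import Data.Product using (∃; _×_; _,_; proj₁; proj₂)
open import Data.Sum using (_⊎_; inj₁; inj₂; [_,_])
open import Data.Empty using (⊥)
open import Relation.Binary.PropositionalEquality using (_≡_; refl)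

record _↝[_]_ {n s : ℕ} (ρ : Fin s → Fin n) (g : Fin n → Subset n) (ρ′ : Fin s → Fin n) : Set where
  constructor pointwise
  field
    at : ∀ i → ρ′ i ∈ g (ρ i)
open _↝[_]_

∷ₐ-↝ : ∀ {n s} {g : Fin n → Subset n} {ρ ρ′ : Fin s → Fin n} {a a′} →
       a′ ∈ g a → ρ ↝[ g ] ρ′ → (a ∷ₐ ρ) ↝[ g ] (a′ ∷ₐ ρ′)
∷ₐ-↝ a↝a′ ρ↝ρ′ .at zero        = a↝a′
∷ₐ-↝ a↝a′ ρ↝ρ′ .at (Fin.suc i) = ρ↝ρ′ .at i

module _ {σ : Signature} {𝓑 : Structure σ} {g : Fin (size 𝓑) → Subset (size 𝓑)}
         (she : IsShe 𝓑 g) where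
  open IsShe she
  open IsShop shop

  she-preserves-⊨ : ∀ {s} (φ : Formula σ s) {ρ ρ′ : Fin s → Fin (size 𝓑)} →
                    ρ ↝[ g ] ρ′ → 𝓑 ⊨ φ [ ρ ] → 𝓑 ⊨ φ [ ρ′ ]
  she-preserves-⊨ (atom R ts) ρ↝ρ′ holds    = preserve R _ _ holds (λ j → ρ↝ρ′ .at (ts j))
  she-preserves-⊨ (φ ∧ᶠ ψ)    ρ↝ρ′ (p , q)  = she-preserves-⊨ φ ρ↝ρ′ p , she-preserves-⊨ ψ ρ↝ρ′ q
  she-preserves-⊨ (φ ∨ᶠ ψ)    ρ↝ρ′ (inj₁ p) = inj₁ (she-preserves-⊨ φ ρ↝ρ′ p)
  she-preserves-⊨ (φ ∨ᶠ ψ)    ρ↝ρ′ (inj₂ q) = inj₂ (she-preserves-⊨ ψ ρ↝ρ′ q)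
  she-preserves-⊨ (∃ᶠ φ)      ρ↝ρ′ (a , p)  =
    let a′ , a↝a′ = nonempty a in a′ , she-preserves-⊨ φ (∷ₐ-↝ a↝a′ ρ↝ρ′) p
  she-preserves-⊨ (∀ᶠ φ)      ρ↝ρ′ p a′     =
    let a , a↝a′ = covering a′ in she-preserves-⊨ φ (∷ₐ-↝ a↝a′ ρ↝ρ′) (p a)

module _ {n : ℕ} {g : Fin n → Subset n} {b : Fin n} {B′ B″ : Subset n}
         (partition : ∀ x → x ∈ B′ ⊎ x ∈ B″)
         (g∋x∧b-on-B′ : ∀ x → x ∈ B′ → x ∈ g x × b ∈ g x)
         (g∋b-on-B″ : ∀ x → x ∈ B″ → b ∈ g x) where

  b∈g : ∀ x → b ∈ g x
  b∈g x = [ (λ x∈B′ → proj₂ (g∋x∧b-on-B′ x x∈B′)) , g∋b-on-B″ x ] (partition x)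

  x∈g[x] : ∀ x → x ∈ B′ ⊎ x ≡ b → x ∈ g x
  x∈g[x] x (inj₁ x∈B′) = proj₁ (g∋x∧b-on-B′ x x∈B′)
  x∈g[x] x (inj₂ refl) = b∈g x

lemma3p8 : ∀ {σ : Signature} (𝓑 : Structure σ) → 2 ≤ size 𝓑 →
    (g : Fin (size 𝓑) → Subset (size 𝓑)) → IsShe 𝓑 g →
    (b : Fin (size 𝓑)) (B′ B″ : Subset (size 𝓑)) →
    (∀ x → x ∈ B′ ⊎ x ∈ B″) →
    (∀ x → x ∈ B′ → x ∈ B″ → ⊥) →
    (∃ λ x → x ∈ B′) →
    (∀ x → x ∈ B′ → x ∈ g x × b ∈ g x) →
    (∀ x → x ∈ B″ → b ∈ g x) →
    (∀ y → ∃ λ x → x ∈ B′ × y ∈ g x) →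
    (k : ℕ) (φ : Formula σ (suc k)) →
    (xs : Fin k → Fin (size 𝓑)) → (∀ i → xs i ∈ B′ ⊎ xs i ≡ b) →
    ((∀ u → u ∈ B′ → 𝓑 ⊨ φ [ u ∷ₐ xs ]) → 𝓑 ⊨ ∀ᶠ φ [ xs ])
    × (𝓑 ⊨ ∃ᶠ φ [ xs ] → 𝓑 ⊨ φ [ b ∷ₐ xs ])
lemma3p8 𝓑 _ g she b B′ B″ partition _ _ g∋x∧b-on-B′ g∋b-on-B″ covered-by-B′ k φ xs xs∈B′∪b =
  universal , existential
  where
  xs↝xs : xs ↝[ g ] xs
  xs↝xs = pointwise λ i → x∈g[x] partition g∋x∧b-on-B′ g∋b-on-B″ (xs i) (xs∈B′∪b i)

  universal : (∀ u → u ∈ B′ → 𝓑 ⊨ φ [ u ∷ₐ xs ]) → 𝓑 ⊨ ∀ᶠ φ [ xs ]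
  universal φ-on-B′ y =
    let x , x∈B′ , y∈g[x] = covered-by-B′ y
    in she-preserves-⊨ she φ (∷ₐ-↝ y∈g[x] xs↝xs) (φ-on-B′ x x∈B′)

  existential : 𝓑 ⊨ ∃ᶠ φ [ xs ] → 𝓑 ⊨ φ [ b ∷ₐ xs ]
  existential (u , φ-at-u) =
    she-preserves-⊨ she φ (∷ₐ-↝ (b∈g partition g∋x∧b-on-B′ g∋b-on-B″ u) xs↝xs) φ-at-u
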